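{- Let $S\subseteq\mathbb{N}^d$ be a generalized numerical semigroup of genus $g$ such that $H(S)$ has a unique maximal element $\mathbf{f}$ with respect to the natural partial order on $\mathbb{N}^d$. Then $2g\geq (f^{(1)}+1)(f^{(2)}+1)\cdots(f^{(d)}+1)$.
   Context: A generalized numerical semigroup (GNS) is a submonoid $S\subseteq\mathbb{N}^d$ such that $H(S)=\mathbb{N}^d\setminus S$ is finite; its genus is $g=|H(S)|$. For $\mathbf{x}\in\mathbb{N}^d$, $x^{(i)}$ denotes its $i$-th component. Natural partial order: $\mathbf{x}\le\mathbf{y}$ iff $x^{(i)}\le y^{(i)}$ for all $i$. -}

module Defs where

open import Data.Nat using (ℕ; zero; suc; _+_; _*_; _≤_)
open import Data.Vec using (Vec; []; _∷_; zipWith; replicate)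
open import Data.Vec.Relation.Binary.Pointwise.Inductive using (Pointwise)
open import Data.List using (List; length)
open import Data.List.Membership.Propositional using (_∈_)
open import Data.List.Relation.Unary.Unique.Propositional using (Unique)
open import Data.Product using (Σ; _×_)
open import Relation.Nullary using (¬_)
open import Relation.Binary.PropositionalEquality using (_≡_)
open import Function.Bundles using (_⇔_)

Pt : ℕ → Set
Pt d = Vec ℕ d

_⊕_ : ∀ {d} → Pt d → Pt d → Pt d
_⊕_ = zipWith _+_

𝟎 : ∀ d → Pt d
𝟎 d = replicate d 0

_≼_ : ∀ {d} → Pt d → Pt d → Set
_≼_ = Pointwise _≤_

prodSuc : ∀ {d} → Pt d → ℕ
prodSuc []       = 1
prodSuc (x ∷ xs) = suc x * prodSuc xs

record IsSubmonoid {d : ℕ} (S : Pt d → Set) : Set where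
  field
    zero∈ : S (𝟎 d)
    +-closed : ∀ x y → S x → S y → S (x ⊕ y)

-- H(S) = ℕ^d ∖ S is finite, listed without repetition by hs
IsHoleList : ∀ {d} → (Pt d → Set) → List (Pt d) → Set
IsHoleList S hs = Unique hs × (∀ x → (x ∈ hs) ⇔ (¬ S x))

record IsGNSOfGenus {d : ℕ} (S : Pt d → Set) (g : ℕ) : Set₁ where
  field
    submonoid : IsSubmonoid S
    holes     : List (Pt d)
    holeList  : IsHoleList S holes
    genus     : length holes ≡ g

H : ∀ {d} → (Pt d → Set) → Pt d → Set
H S x = ¬ S x

IsMaximalHole : ∀ {d} → (Pt d → Set) → Pt d → Set
IsMaximalHole S m = H S m × (∀ h → H S h → m ≼ h → h ≡ m)

IsUniqueMaximalHole : ∀ {d} → (Pt d → Set) → Pt d → Set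
IsUniqueMaximalHole S f = IsMaximalHole S f × (∀ m → IsMaximalHole S m → m ≡ f)

module Submission where

-- Let f be a hole of the generalized numerical semigroup S.  For every x ≼ f put x* = f − x, so
-- that x + x* = f.  If x and x* were both in S, then f = x + x* would be in
-- S; hence x or x* is a hole.  So every point of the box {x ∣ x ≼ f}, which
-- has (f⁽¹⁾+1)⋯(f⁽ᵈ⁾+1) elements, lies in H(S) ∪ (f − H(S)), a set with at
-- most 2g elements.

open import Defs
open import Data.Nat using (ℕ; suc; _+_; _*_; _∸_; _≤_; _≥_; z≤n; s≤s; _≟_)
open import Data.Nat.Properties
  using (+-identityʳ; ≤-pred; m∸[m∸n]≡n; m+[n∸m]≡n; module ≤-Reasoning)
open import Data.Vec using ([]; _∷_; zipWith)
open import Data.Vec.Properties using (≡-dec; ∷-injective)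
open import Data.Vec.Relation.Binary.Pointwise.Inductive using ([]; _∷_)
open import Data.List using (List; []; _∷_; [_]; length; map; _++_; upTo; cartesianProductWith)
open import Data.List.Properties using (length-++; length-map; length-upTo; length-removeAt′)
open import Data.List.Membership.Propositional using (_∈_)
open import Data.List.Membership.Propositional.Properties
  using (∈-++⁺ˡ; ∈-++⁺ʳ; ∈-map⁺; ∈-upTo⁻; ∈-cartesianProductWith⁻)
import Data.List.Membership.DecPropositional as DecMembership
open import Data.List.Relation.Binary.Subset.Propositional using (_⊆_)
open import Data.List.Relation.Unary.Any using (here; there; index; _─_)
import Data.List.Relation.Unary.All as All
import Data.List.Relation.Unary.AllPairs as AllPairs
open import Data.List.Relation.Unary.Unique.Propositional using (Unique)
open import Data.List.Relation.Unary.Unique.Propositional.Properties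
  using (upTo⁺; cartesianProductWith⁺)
open import Data.Product using (_,_)
open import Data.Empty using (⊥-elim)
open import Relation.Nullary using (¬_; Dec; yes; no)
open import Relation.Binary.PropositionalEquality using (_≡_; _≢_; refl; sym; cong; cong₂; subst; module ≡-Reasoning)
open import Function.Bundles using (Equivalence)

module _ {A : Set} where

  ∈-─ : ∀ {x z : A} {ys : List A} (p : x ∈ ys) → z ∈ ys → x ≢ z → z ∈ (ys ─ p)
  ∈-─ (here refl) (here refl) x≢z = ⊥-elim (x≢z refl)
  ∈-─ (here _)    (there q)   _   = q
  ∈-─ (there _)   (here refl) _   = here refl
  ∈-─ (there p)   (there q)   x≢z = there (∈-─ p q x≢z)

  unique-⊆⇒length≤ : ∀ {xs ys : List A} → Unique xs → xs ⊆ ys → length xs ≤ length ys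
  unique-⊆⇒length≤ {[]}     _           _  = z≤n
  unique-⊆⇒length≤ {x ∷ xs} {ys} (x∉xs AllPairs.∷ u) xs⊆ys =
    subst (suc (length xs) ≤_) (sym (length-removeAt′ ys (index x∈ys)))
      (s≤s (unique-⊆⇒length≤ u (λ z∈xs → ∈-─ x∈ys (xs⊆ys (there z∈xs)) (All.lookup x∉xs z∈xs))))
    where
    x∈ys : x ∈ ys
    x∈ys = xs⊆ys (here refl)

  length-++-map : ∀ (g : A → A) (xs : List A) → length (xs ++ map g xs) ≡ 2 * length xs
  length-++-map g xs = begin
      length (xs ++ map g xs)          ≡⟨ length-++ xs ⟩
      length xs + length (map g xs)    ≡⟨ cong (length xs +_) (length-map g xs) ⟩
      length xs + length xs            ≡⟨ cong (length xs +_) (+-identityʳ (length xs)) ⟨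
      2 * length xs                    ∎
    where open ≡-Reasoning

box : ∀ {d} → Pt d → List (Pt d)
box []      = [ [] ]
box (a ∷ f) = cartesianProductWith _∷_ (upTo (suc a)) (box f)

length-cartesianProductWith : ∀ {A B C : Set} (g : A → B → C) (xs : List A) (ys : List B) →
  length (cartesianProductWith g xs ys) ≡ length xs * length ys
length-cartesianProductWith g []       ys = refl
length-cartesianProductWith g (x ∷ xs) ys = begin
    length (map (g x) ys ++ cartesianProductWith g xs ys)
      ≡⟨ length-++ (map (g x) ys) ⟩
    length (map (g x) ys) + length (cartesianProductWith g xs ys)
      ≡⟨ cong₂ _+_ (length-map (g x) ys) (length-cartesianProductWith g xs ys) ⟩
    length ys + length xs * length ys
      ∎
  where open ≡-Reasoning

length-box : ∀ {d} (f : Pt d) → length (box f) ≡ prodSuc f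
length-box []      = refl
length-box (a ∷ f) = begin
    length (box (a ∷ f))                     ≡⟨ length-cartesianProductWith _∷_ (upTo (suc a)) (box f) ⟩
    length (upTo (suc a)) * length (box f)   ≡⟨ cong₂ _*_ (length-upTo (suc a)) (length-box f) ⟩
    suc a * prodSuc f                        ∎
  where open ≡-Reasoning

box-unique : ∀ {d} (f : Pt d) → Unique (box f)
box-unique []      = All.[] AllPairs.∷ AllPairs.[]
box-unique (a ∷ f) = cartesianProductWith⁺ _∷_ ∷-injective (upTo⁺ (suc a)) (box-unique f)

box-sound : ∀ {d} (f : Pt d) {x : Pt d} → x ∈ box f → x ≼ f
box-sound []      (here refl) = []
box-sound (a ∷ f) x∈box with ∈-cartesianProductWith⁻ _∷_ (upTo (suc a)) (box f) x∈box
... | _ , _ , i∈ , y∈ , refl = ≤-pred (∈-upTo⁻ i∈) ∷ box-sound f y∈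

complement : ∀ {d} → Pt d → Pt d → Pt d
complement f x = zipWith _∸_ f x

complement-involutive : ∀ {d} {f x : Pt d} → x ≼ f → complement f (complement f x) ≡ x
complement-involutive []            = refl
complement-involutive (i≤a ∷ x≼f) = cong₂ _∷_ (m∸[m∸n]≡n i≤a) (complement-involutive x≼f)

⊕-complement : ∀ {d} {f x : Pt d} → x ≼ f → x ⊕ complement f x ≡ f
⊕-complement []            = refl
⊕-complement (i≤a ∷ x≼f) = cong₂ _∷_ (m+[n∸m]≡n i≤a) (⊕-complement x≼f)

-- Key fact: below a hole f of a submonoid, if x is not a hole then f − x
-- is one, since otherwise f = x + (f − x) would lie in S.
complement-of-non-hole : ∀ {d} {S : Pt d → Set} → IsSubmonoid S →
  ∀ {f x} → H S f → x ≼ f → ¬ H S x → H S (complement f x)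
complement-of-non-hole {S = S} submonoid {f} {x} f-hole x≼f x-not-hole x*∈S =
  x-not-hole (λ x∈S → f-hole (subst S (⊕-complement x≼f) (+-closed x (complement f x) x∈S x*∈S)))
  where open IsSubmonoid submonoid

_∈?_ : ∀ {d} (x : Pt d) (xs : List (Pt d)) → Dec (x ∈ xs)
_∈?_ = DecMembership._∈?_ (≡-dec _≟_)

box⊆holes∪complements : ∀ {d} {S : Pt d → Set} {hs : List (Pt d)} {f : Pt d} →
  IsSubmonoid S → IsHoleList S hs → H S f → box f ⊆ hs ++ map (complement f) hs
box⊆holes∪complements {hs = hs} {f} submonoid (_ , isHole) f-hole {x} x∈box
  with x ∈? hs
... | yes x∈hs = ∈-++⁺ˡ x∈hs
... | no  x∉hs = subst (_∈ hs ++ map (complement f) hs) (complement-involutive x≼f)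
                   (∈-++⁺ʳ hs (∈-map⁺ (complement f) x*∈hs))
  where
  x≼f : x ≼ f
  x≼f = box-sound f x∈box
  x*∈hs : complement f x ∈ hs
  x*∈hs = Equivalence.from (isHole (complement f x))
            (complement-of-non-hole submonoid f-hole x≼f
              (λ x-hole → x∉hs (Equivalence.from (isHole x) x-hole)))

mainTheorem19 : (d : ℕ) (S : Pt d → Set) (g : ℕ) (f : Pt d)
    → IsGNSOfGenus S g
    → IsUniqueMaximalHole S f
    → 2 * g ≥ prodSuc f
mainTheorem19 d S g f gns ((f-hole , _) , _) = begin
    prodSuc f                                           ≡⟨ length-box f ⟨
    length (box f)                                      ≤⟨ unique-⊆⇒length≤ (box-unique f)
                                                             (box⊆holes∪complements submonoid holeList f-hole) ⟩
    length (holes ++ map (complement f) holes)          ≡⟨ length-++-map (complement f) holes ⟩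
    2 * length holes                                    ≡⟨ cong (2 *_) genus ⟩
    2 * g                                               ∎
  where
  open IsGNSOfGenus gns
  open ≤-Reasoning
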